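{- Let $G$ be a graph of order $n\ge 3$ with no isolated vertices. Then \[ n-\gamma^t_2(G)\le \operatorname{Z_-IR}(G)\le n-\gamma(G),\] and both bounds are sharp, i.e., each holds with equality for some graph satisfying the hypotheses.
   Context: Graphs are finite, simple, undirected. $\gamma(G)$ is the domination number. A set $D\subseteq V(G)$ is a total 2-dominating set if every vertex of $G$ is adjacent to at least two vertices of $D$; $\gamma^t_2(G)$ is the minimum cardinality of a total 2-dominating set (taken as $+\infty$ if none exists). A skew fort of $G$ is a nonempty $F\subseteq V(G)$ such that $|N(v)\cap F|\ne 1$ for every $v\in V(G)$ (here $N(v)$ is the open neighborhood). $S\subseteq V(G)$ is a $\operatorname{Z}_-$Ir-set if for every $u\in S$ there is a skew fort $F$ with $S\cap F=\{u\}$. $\operatorname{Z_-IR}(G)$ is the maximum cardinality of a $\operatorname{Z}_-$Ir-set of $G$. -}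

module Defs where

open import Data.Nat using (ℕ; _≤_; _∸_)
open import Data.Bool using (Bool; true; false)
open import Data.Fin using (Fin)
open import Data.Fin.Subset using (Subset; _∈_; _∩_; ∣_∣; ⁅_⁆; Nonempty)
open import Data.Vec using (tabulate)
open import Data.Product using (Σ; ∃; _×_)
open import Data.Sum using (_⊎_)
open import Relation.Binary.PropositionalEquality using (_≡_; _≢_)

record Graph (n : ℕ) : Set where
  field
    adj    : Fin n → Fin n → Bool
    sym    : ∀ u v → adj u v ≡ adj v u
    irrefl : ∀ v → adj v v ≡ false
open Graph public

N : ∀ {n} → Graph n → Fin n → Subset n
N G v = tabulate (adj G v)

NoIsolated : ∀ {n} → Graph n → Set
NoIsolated G = ∀ v → ∃ λ u → adj G v u ≡ true

Dominating : ∀ {n} → Graph n → Subset n → Set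
Dominating G D = ∀ v → v ∈ D ⊎ (∃ λ u → u ∈ D × adj G v u ≡ true)

Total2Dominating : ∀ {n} → Graph n → Subset n → Set
Total2Dominating G D = ∀ v → 2 ≤ ∣ N G v ∩ D ∣

SkewFort : ∀ {n} → Graph n → Subset n → Set
SkewFort G F = Nonempty F × (∀ v → ∣ N G v ∩ F ∣ ≢ 1)

ZIrSet : ∀ {n} → Graph n → Subset n → Set
ZIrSet G S = ∀ u → u ∈ S → ∃ λ F → SkewFort G F × (S ∩ F ≡ ⁅ u ⁆)

IsMinCard : ∀ {n} → (Subset n → Set) → ℕ → Set
IsMinCard P k = (∃ λ D → P D × ∣ D ∣ ≡ k) × (∀ D → P D → k ≤ ∣ D ∣)

IsMaxCard : ∀ {n} → (Subset n → Set) → ℕ → Set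
IsMaxCard P k = (∃ λ D → P D × ∣ D ∣ ≡ k) × (∀ D → P D → ∣ D ∣ ≤ k)

IsDominationNumber : ∀ {n} → Graph n → ℕ → Set
IsDominationNumber G = IsMinCard (Dominating G)

-- γ^t_2(G) = k (finite); if no total 2-dominating set exists, no k satisfies this (γ^t_2 = ∞)
IsTotal2DominationNumber : ∀ {n} → Graph n → ℕ → Set
IsTotal2DominationNumber G = IsMinCard (Total2Dominating G)

IsZIR : ∀ {n} → Graph n → ℕ → Set
IsZIR G = IsMaxCard (ZIrSet G)

-- For a total 2-dominating set D and u ∉ D, the set D ∪ {u} is a skew fort (every vertex
-- already has two neighbours in D) meeting ∁ D exactly in u; so ∁ D is a Z₋Ir-set.
-- Conversely, for a Z₋Ir-set S every vertex v has a neighbour outside S: otherwise the skew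
-- fort of a neighbour w of v would meet N(v) exactly in w. So ∁ S is dominating.
-- Sharpness holds for the house graph (Z₋IR = 1, γᵗ₂ = 4) and the 4-cycle (Z₋IR = γ = 2),
-- both decided by exhaustive search over vertex subsets.
module Submission where

open import Defs
open import Data.Bool using (Bool; true; false; _∧_; _∨_; _≟_)
open import Data.Bool.Properties using (∨-comm)
open import Data.Empty using (⊥-elim)
open import Data.Fin using (Fin; toℕ)
open import Data.Fin.Properties using (all?; any?)
open import Data.Fin.Subset using (Subset; _∈_; _∉_; _⊆_; _∩_; _∪_; ∁; ∣_∣; ⁅_⁆; Nonempty)
open import Data.Fin.Subset.Properties
  using ( _∈?_; nonempty?; anySubset?; ⊆-antisym; ∣p∣≤n; p⊆q⇒∣p∣≤∣q∣; ∣∁p∣≡n∸∣p∣; ∣⁅x⁆∣≡1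
        ; x∈⁅x⁆; x∈⁅y⁆⇒x≡y; x∈p∩q⁺; x∈p∩q⁻; x∈p∪q⁺; x∈p∪q⁻; x∈∁p⇒x∉p; x∉p⇒x∈∁p; x∉∁p⇒x∈p )
open import Data.List using (List; []; _∷_)
open import Data.Bool.ListAction using (any)
open import Data.Nat using (ℕ; _≤_; _∸_; _≤?_; _≡ᵇ_; s≤s; z≤n) renaming (_≟_ to _≟ℕ_)
open import Data.Nat.Properties using (≤-trans; ∸-monoʳ-≤; m∸[m∸n]≡n; m≤n⇒m≤1+n; module ≤-Reasoning)
open import Data.Product using (Σ; ∃; _×_; _,_; proj₂)
open import Data.Sum using (inj₁; inj₂)
open import Data.Unit using (tt)
open import Data.Vec.Properties using (≡-dec; lookup∘tabulate; []=⇒lookup; lookup⇒[]=)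
open import Relation.Binary.PropositionalEquality using (_≡_; refl; trans; cong; subst)
  renaming (sym to ≡-sym)
open import Relation.Nullary using (Dec; yes; no; ¬_; contradiction)
open import Relation.Nullary.Decidable using (True; toWitness; ¬?; _×-dec_; _⊎-dec_; _→-dec_; decidable-stable)
open import Relation.Unary using (Decidable)

∁-∩-∪⁅⁆ : ∀ {n} (D : Subset n) {u} → u ∉ D → ∁ D ∩ (D ∪ ⁅ u ⁆) ≡ ⁅ u ⁆
∁-∩-∪⁅⁆ D {u} u∉D = ⊆-antisym ⊆⁅u⁆ ⁅u⁆⊆
  where
  ⊆⁅u⁆ : ∁ D ∩ (D ∪ ⁅ u ⁆) ⊆ ⁅ u ⁆
  ⊆⁅u⁆ {x} x∈ with x∈p∩q⁻ (∁ D) (D ∪ ⁅ u ⁆) x∈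
  ... | x∈∁D , x∈D∪u with x∈p∪q⁻ D ⁅ u ⁆ x∈D∪u
  ...   | inj₁ x∈D = contradiction x∈D (x∈∁p⇒x∉p x∈∁D)
  ...   | inj₂ x∈u = x∈u
  ⁅u⁆⊆ : ⁅ u ⁆ ⊆ ∁ D ∩ (D ∪ ⁅ u ⁆)
  ⁅u⁆⊆ x∈u with x∈⁅y⁆⇒x≡y u x∈u
  ... | refl = x∈p∩q⁺ (x∉p⇒x∈∁p u∉D , x∈p∪q⁺ (inj₂ x∈u))

module _ {n : ℕ} (G : Graph n) where

  ∈N⇒adj : ∀ {v x} → x ∈ N G v → adj G v x ≡ true
  ∈N⇒adj {v} {x} x∈N = trans (≡-sym (lookup∘tabulate (adj G v) x)) ([]=⇒lookup x∈N)

  adj⇒∈N : ∀ {v x} → adj G v x ≡ true → x ∈ N G v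
  adj⇒∈N {v} {x} vx = lookup⇒[]= x (N G v) (trans (lookup∘tabulate (adj G v) x) vx)

  total2Dominating-⊆⇒skewFort : ∀ {D F} → Total2Dominating G D → D ⊆ F → Nonempty F → SkewFort G F
  total2Dominating-⊆⇒skewFort {D} {F} td D⊆F ne = ne , λ v card≡1 →
    2≰1 (subst (2 ≤_) card≡1 (≤-trans (td v) (p⊆q⇒∣p∣≤∣q∣ (N∩D⊆N∩F v))))
    where
    2≰1 : ¬ 2 ≤ 1
    2≰1 (s≤s ())
    N∩D⊆N∩F : ∀ v → N G v ∩ D ⊆ N G v ∩ F
    N∩D⊆N∩F v x∈ with x∈p∩q⁻ (N G v) D x∈
    ... | x∈N , x∈D = x∈p∩q⁺ (x∈N , D⊆F x∈D)

  total2Dominating⇒∁-ZIrSet : ∀ {D} → Total2Dominating G D → ZIrSet G (∁ D)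
  total2Dominating⇒∁-ZIrSet {D} td u u∈∁D =
    D ∪ ⁅ u ⁆ ,
    total2Dominating-⊆⇒skewFort td (λ x∈D → x∈p∪q⁺ (inj₁ x∈D)) (u , x∈p∪q⁺ (inj₂ (x∈⁅x⁆ u))) ,
    ∁-∩-∪⁅⁆ D (x∈∁p⇒x∉p u∈∁D)

  ZIrSet⇒N⊈ : ∀ {S v w} → ZIrSet G S → adj G v w ≡ true → ¬ (N G v ⊆ S)
  ZIrSet⇒N⊈ {S} {v} {w} zs vw N⊆S with zs w (N⊆S (adj⇒∈N vw))
  ... | F , (_ , notOne) , S∩F≡w = notOne v (trans (cong ∣_∣ N∩F≡w) (∣⁅x⁆∣≡1 w))
    where
    N∩F≡w : N G v ∩ F ≡ ⁅ w ⁆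
    N∩F≡w = ⊆-antisym
      (λ x∈ → let x∈N , x∈F = x∈p∩q⁻ (N G v) F x∈ in subst (_ ∈_) S∩F≡w (x∈p∩q⁺ (N⊆S x∈N , x∈F)))
      (λ x∈w → subst (λ x → x ∈ N G v ∩ F) (≡-sym (x∈⁅y⁆⇒x≡y w x∈w))
        (x∈p∩q⁺ (adj⇒∈N vw , proj₂ (x∈p∩q⁻ S F (subst (w ∈_) (≡-sym S∩F≡w) (x∈⁅x⁆ w))))))

  ZIrSet⇒∁-totalDominating : ∀ {S} → NoIsolated G → ZIrSet G S →
                             ∀ v → ∃ λ u → u ∈ ∁ S × adj G v u ≡ true
  ZIrSet⇒∁-totalDominating {S} noIso zs v
    with any? (λ u → (u ∈? ∁ S) ×-dec (adj G v u ≟ true))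
  ... | yes found = found
  ... | no none   = ⊥-elim (ZIrSet⇒N⊈ zs (proj₂ (noIso v)) N⊆S)
    where
    N⊆S : N G v ⊆ S
    N⊆S x∈N = x∉∁p⇒x∈p (λ x∈∁S → none (_ , x∈∁S , ∈N⇒adj x∈N))

  ZIrSet⇒∁-dominating : ∀ {S} → NoIsolated G → ZIrSet G S → Dominating G (∁ S)
  ZIrSet⇒∁-dominating noIso zs v = inj₂ (ZIrSet⇒∁-totalDominating noIso zs v)

module _ {n : ℕ} {P Q : Subset n → Set} where

  n∸minCard≤maxCard : (∀ D → Q D → P (∁ D)) → ∀ {z t} → IsMaxCard P z → IsMinCard Q t → n ∸ t ≤ z
  n∸minCard≤maxCard Q⇒P∁ (_ , maximal) ((D , QD , ∣D∣≡t) , _) =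
    subst (_≤ _) (trans (∣∁p∣≡n∸∣p∣ D) (cong (n ∸_) ∣D∣≡t)) (maximal (∁ D) (Q⇒P∁ D QD))

  maxCard≤n∸minCard : (∀ S → P S → Q (∁ S)) → ∀ {z g} → IsMaxCard P z → IsMinCard Q g → z ≤ n ∸ g
  maxCard≤n∸minCard P⇒Q∁ {z} {g} ((S , PS , ∣S∣≡z) , _) (_ , minimal) = begin
    z                 ≡⟨ ≡-sym ∣S∣≡z ⟩
    ∣ S ∣             ≡⟨ ≡-sym (m∸[m∸n]≡n (∣p∣≤n S)) ⟩
    n ∸ (n ∸ ∣ S ∣)   ≤⟨ ∸-monoʳ-≤ n (subst (g ≤_) (∣∁p∣≡n∸∣p∣ S) (minimal (∁ S) (P⇒Q∁ S PS))) ⟩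
    n ∸ g             ∎
    where open ≤-Reasoning

∀-Subset? : ∀ {n} {P : Subset n → Set} → Decidable P → Dec (∀ S → P S)
∀-Subset? P? with anySubset? (λ S → ¬? (P? S))
... | yes (S , ¬PS) = no (λ all → ¬PS (all S))
... | no  ¬∃¬P      = yes (λ S → decidable-stable (P? S) (λ ¬PS → ¬∃¬P (S , ¬PS)))

isMaxCard? : ∀ {n} {P : Subset n → Set} → Decidable P → ∀ k → Dec (IsMaxCard P k)
isMaxCard? P? k = anySubset? (λ D → P? D ×-dec (∣ D ∣ ≟ℕ k))
             ×-dec ∀-Subset? (λ D → P? D →-dec (∣ D ∣ ≤? k))

isMinCard? : ∀ {n} {P : Subset n → Set} → Decidable P → ∀ k → Dec (IsMinCard P k)
isMinCard? P? k = anySubset? (λ D → P? D ×-dec (∣ D ∣ ≟ℕ k))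
             ×-dec ∀-Subset? (λ D → P? D →-dec (k ≤? ∣ D ∣))

module _ {n : ℕ} (G : Graph n) where

  noIsolated? : Dec (NoIsolated G)
  noIsolated? = all? (λ v → any? (λ u → adj G v u ≟ true))

  dominating? : Decidable (Dominating G)
  dominating? D = all? (λ v → (v ∈? D) ⊎-dec any? (λ u → (u ∈? D) ×-dec (adj G v u ≟ true)))

  total2Dominating? : Decidable (Total2Dominating G)
  total2Dominating? D = all? (λ v → 2 ≤? ∣ N G v ∩ D ∣)

  skewFort? : Decidable (SkewFort G)
  skewFort? F = nonempty? F ×-dec all? (λ v → ¬? (∣ N G v ∩ F ∣ ≟ℕ 1))

  ZIrSet? : Decidable (ZIrSet G)
  ZIrSet? S = all? (λ u → (u ∈? S) →-dec anySubset? (λ F → skewFort? F ×-dec ≡-dec _≟_ (S ∩ F) ⁅ u ⁆))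

listsEdge : List (ℕ × ℕ) → ℕ → ℕ → Bool
listsEdge es a b = any (λ (x , y) → (x ≡ᵇ a) ∧ (y ≡ᵇ b)) es

edgeListAdj : ∀ {n} → List (ℕ × ℕ) → Fin n → Fin n → Bool
edgeListAdj es u v = listsEdge es (toℕ u) (toℕ v) ∨ listsEdge es (toℕ v) (toℕ u)

fromEdges : ∀ n (es : List (ℕ × ℕ)) → True (all? (λ v → edgeListAdj {n} es v v ≟ false)) → Graph n
fromEdges n es loopless = record
  { adj    = edgeListAdj es
  ; sym    = λ u v → ∨-comm (listsEdge es (toℕ u) (toℕ v)) (listsEdge es (toℕ v) (toℕ u))
  ; irrefl = toWitness loopless
  }

cycle₄ : Graph 4
cycle₄ = fromEdges 4 ((0 , 1) ∷ (1 , 2) ∷ (2 , 3) ∷ (3 , 0) ∷ []) tt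

house : Graph 5
house = fromEdges 5 ((0 , 1) ∷ (1 , 2) ∷ (2 , 3) ∷ (3 , 0) ∷ (0 , 4) ∷ (1 , 4) ∷ []) tt

house-ZIR≡1 : IsZIR house 1
house-ZIR≡1 = toWitness {a? = isMaxCard? (ZIrSet? house) 1} tt

house-γᵗ₂≡4 : IsTotal2DominationNumber house 4
house-γᵗ₂≡4 = toWitness {a? = isMinCard? (total2Dominating? house) 4} tt

cycle₄-ZIR≡2 : IsZIR cycle₄ 2
cycle₄-ZIR≡2 = toWitness {a? = isMaxCard? (ZIrSet? cycle₄) 2} tt

cycle₄-γ≡2 : IsDominationNumber cycle₄ 2
cycle₄-γ≡2 = toWitness {a? = isMinCard? (dominating? cycle₄) 2} tt

proposition3p44 :
    ((n : ℕ) (G : Graph n) → 3 ≤ n → NoIsolated G →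
      (∀ z t → IsZIR G z → IsTotal2DominationNumber G t → n ∸ t ≤ z)
      × (∀ z g → IsZIR G z → IsDominationNumber G g → z ≤ n ∸ g))
    × (∃ λ n → Σ (Graph n) λ G → 3 ≤ n × NoIsolated G ×
        (∃ λ z → ∃ λ t → IsZIR G z × IsTotal2DominationNumber G t × n ∸ t ≡ z))
    × (∃ λ n → Σ (Graph n) λ G → 3 ≤ n × NoIsolated G ×
        (∃ λ z → ∃ λ g → IsZIR G z × IsDominationNumber G g × z ≡ n ∸ g))
proposition3p44 =
  bounds ,
  (5 , house , m≤n⇒m≤1+n 3≤4 , toWitness {a? = noIsolated? house} tt , 1 , 4 , house-ZIR≡1 , house-γᵗ₂≡4 , refl) ,
  (4 , cycle₄ , 3≤4 , toWitness {a? = noIsolated? cycle₄} tt , 2 , 2 , cycle₄-ZIR≡2 , cycle₄-γ≡2 , refl)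
  where
  bounds : (n : ℕ) (G : Graph n) → 3 ≤ n → NoIsolated G →
           (∀ z t → IsZIR G z → IsTotal2DominationNumber G t → n ∸ t ≤ z)
           × (∀ z g → IsZIR G z → IsDominationNumber G g → z ≤ n ∸ g)
  bounds n G _ noIso =
    (λ _ _ → n∸minCard≤maxCard (λ _ → total2Dominating⇒∁-ZIrSet G)) ,
    (λ _ _ → maxCard≤n∸minCard (λ _ → ZIrSet⇒∁-dominating G noIso))

  3≤4 : 3 ≤ 4
  3≤4 = s≤s (s≤s (s≤s z≤n))
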